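{- For every $n \geq 0$, the number of distinct factors of length $n$ of $\mathbf{b}$ equals $F_{n+2}$.
   Context: Define finite binary words $B_i$ by $B_1 = 101$ and $B_{i+1} = B_i C_i$ for $i \geq 1$, where $C_i$ is the word obtained from $B_i$ by removing its first $i$ symbols. Since each $B_i$ is a prefix of $B_{i+1}$, there is a unique infinite binary word $\mathbf{b}$ of which every $B_i$ is a prefix. A factor is a contiguous subword. The Fibonacci numbers are $F_0 = 0$, $F_1 = 1$, $F_n = F_{n-1} + F_{n-2}$ for $n \geq 2$. -}

module Defs where

open import Data.Nat using (ℕ; zero; suc; _+_)
open import Data.Bool using (Bool; true; false)
open import Data.List using (List; []; _∷_; _++_; drop; length)
open import Data.Product using (∃)
open import Relation.Binary.PropositionalEquality using (_≡_)

F : ℕ → ℕ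
F zero = 0
F (suc zero) = 1
F (suc (suc n)) = F (suc n) + F n

-- Bword i = B_{i+1} (0-indexed shift):  B_1 = 101,
-- B_{i+1} = B_i C_i where C_i = B_i with its first i symbols removed.
Bword : ℕ → List Bool
Bword zero = true ∷ false ∷ true ∷ []
Bword (suc k) = Bword k ++ drop (suc k) (Bword k)

nth : List Bool → ℕ → Bool
nth [] _ = false
nth (x ∷ _) zero = x
nth (_ ∷ xs) (suc n) = nth xs n

-- the infinite word b, as a function ℕ → Bool.  Since |B_{n+1}| > n and
-- every B_i is a prefix of b, position n of b is position n of B_{n+1}.
b : ℕ → Bool
b n = nth (Bword n) n

window : ℕ → ℕ → List Bool
window i zero = []
window i (suc n) = b i ∷ window (suc i) n

IsFactor : ℕ → List Bool → Set
IsFactor n w = ∃ λ i → w ≡ window i n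

-- A word is a factor of b iff it has no two consecutive 0s; such words of length n are
-- empty, 0, 1w or 01w, so they number F (n + 2).  Since B_{k+1} = B_k C_k and C_k is the
-- part of B_k from position k + 1 on, the letters of b following B_k repeat C_k,
-- and every B_k ends in 01.  The first fact lets "no 00" pass from B_k to
-- B_{k+1}.  Conversely, if w is a prefix of C_k, then 1w and 01w occur in B_{k+1} starting
-- at the last, resp. penultimate, letter of B_k; that position is k′ + 1 for some k′ > k,
-- so 1w and 01w are prefixes of C_{k′} (for 01w this needs k ≥ 1).  Induction on the
-- shape of a 00-free word therefore places it in some C_k.
module Submission where

open import Defs
open import Data.Nat using (ℕ; _+_)
open import Relation.Binary.PropositionalEquality using (_≡_)
open import Data.Bool using (Bool)
open import Data.List using (List; length)
open import Data.List.Relation.Unary.Unique.Propositional using (Unique)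
open import Data.List.Membership.Propositional using (_∈_)
open import Data.Product using (Σ; _×_)
open import Function.Bundles using (_⇔_)

open import Data.Bool using (true; false)
open import Data.List using ([]; _∷_; _++_; drop; map)
open import Data.List.Membership.Propositional.Properties using (∈-map⁺; ∈-map⁻; ∈-++⁺ˡ; ∈-++⁺ʳ; ∈-++⁻)
open import Data.List.Properties using (length-++; length-drop; length-map)
open import Data.List.Relation.Unary.AllPairs using ([]; _∷_)
open import Data.List.Relation.Unary.All using ([]; _∷_)
open import Data.List.Relation.Unary.Any using (here; there)
import Data.List.Relation.Unary.Unique.Propositional.Properties as Unique
open import Data.Nat using (zero; suc; _∸_; _≤_; _<_; z≤n; s≤s; s<s; z<s)
open import Data.Nat.Properties
open import Data.Nat.Tactic.RingSolver using (solve-∀)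
open import Data.Product using (∃; _,_)
open import Data.Sum using (inj₁; inj₂)
open import Function.Base using (_∘_)
open import Function.Bundles using (mk⇔)
import Function.Properties.Equivalence as ⇔
open import Relation.Binary.Definitions using (tri<; tri≈; tri>)
open import Relation.Binary.PropositionalEquality using (refl; sym; trans; cong; cong₂; subst; subst₂; module ≡-Reasoning)
open import Relation.Nullary using (¬_)
open ≡-Reasoning

data No00 : ℕ → List Bool → Set where
  []   : No00 0 []
  [0]  : No00 1 (false ∷ [])
  1∷_  : ∀ {n w} → No00 n w → No00 (suc n) (true ∷ w)
  01∷_ : ∀ {n w} → No00 n w → No00 (2 + n) (false ∷ true ∷ w)

no00Words : ℕ → List (List Bool)
no00Words zero = [] ∷ []
no00Words (suc zero) = (true ∷ []) ∷ (false ∷ []) ∷ []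
no00Words (suc (suc n)) = map (true ∷_) (no00Words (suc n)) ++ map (λ w → false ∷ true ∷ w) (no00Words n)

length-no00Words : ∀ n → length (no00Words n) ≡ F (2 + n)
length-no00Words zero = refl
length-no00Words (suc zero) = refl
length-no00Words (suc (suc n)) = begin
  length (map (true ∷_) (no00Words (suc n)) ++ map (λ w → false ∷ true ∷ w) (no00Words n))
    ≡⟨ length-++ (map (true ∷_) (no00Words (suc n))) ⟩
  length (map (true ∷_) (no00Words (suc n))) + length (map (λ w → false ∷ true ∷ w) (no00Words n))
    ≡⟨ cong₂ _+_ (length-map _ (no00Words (suc n))) (length-map _ (no00Words n)) ⟩
  length (no00Words (suc n)) + length (no00Words n)
    ≡⟨ cong₂ _+_ (length-no00Words (suc n)) (length-no00Words n) ⟩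
  F (3 + n) + F (2 + n) ∎

∈-no00Words⁻ : ∀ n {w} → w ∈ no00Words n → No00 n w
∈-no00Words⁻ zero (here refl) = []
∈-no00Words⁻ (suc zero) (here refl) = 1∷ []
∈-no00Words⁻ (suc zero) (there (here refl)) = [0]
∈-no00Words⁻ (suc (suc n)) w∈ with ∈-++⁻ (map (true ∷_) (no00Words (suc n))) w∈
... | inj₁ w∈₁ with ∈-map⁻ (true ∷_) w∈₁
...   | v , v∈ , refl = 1∷ ∈-no00Words⁻ (suc n) v∈
∈-no00Words⁻ (suc (suc n)) w∈ | inj₂ w∈₂ with ∈-map⁻ (λ w → false ∷ true ∷ w) w∈₂
...   | v , v∈ , refl = 01∷ ∈-no00Words⁻ n v∈

∈-no00Words⁺ : ∀ {n w} → No00 n w → w ∈ no00Words n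
∈-no00Words⁺ [] = here refl
∈-no00Words⁺ [0] = there (here refl)
∈-no00Words⁺ (1∷ []) = here refl
∈-no00Words⁺ (1∷_ {suc n} w) = ∈-++⁺ˡ (∈-map⁺ (true ∷_) (∈-no00Words⁺ w))
∈-no00Words⁺ (01∷_ {n} w) =
  ∈-++⁺ʳ (map (true ∷_) (no00Words (suc n))) (∈-map⁺ (λ w → false ∷ true ∷ w) (∈-no00Words⁺ w))

∈-no00Words⇔ : ∀ {n w} → w ∈ no00Words n ⇔ No00 n w
∈-no00Words⇔ {n} = mk⇔ (∈-no00Words⁻ n) ∈-no00Words⁺

no00Words-unique : ∀ n → Unique (no00Words n)
no00Words-unique zero = [] ∷ []
no00Words-unique (suc zero) = ((λ ()) ∷ []) ∷ [] ∷ []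
no00Words-unique (suc (suc n)) =
  Unique.++⁺ (Unique.map⁺ 1∷-injective (no00Words-unique (suc n)))
             (Unique.map⁺ 01∷-injective (no00Words-unique n))
             disjoint
  where
  1∷-injective : ∀ {v w : List Bool} → true ∷ v ≡ true ∷ w → v ≡ w
  1∷-injective refl = refl
  01∷-injective : ∀ {v w : List Bool} → false ∷ true ∷ v ≡ false ∷ true ∷ w → v ≡ w
  01∷-injective refl = refl
  disjoint : ∀ {w} → ¬ (w ∈ map (true ∷_) (no00Words (suc n)) × w ∈ map (λ w → false ∷ true ∷ w) (no00Words n))
  disjoint (w∈₁ , w∈₂) with ∈-map⁻ (true ∷_) w∈₁ | ∈-map⁻ (λ w → false ∷ true ∷ w) w∈₂
  ... | _ , _ , refl | _ , _ , ()

nth-++ˡ : ∀ xs ys {p} → p < length xs → nth (xs ++ ys) p ≡ nth xs p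
nth-++ˡ (x ∷ xs) ys {zero} _ = refl
nth-++ˡ (x ∷ xs) ys {suc p} (s<s p<) = nth-++ˡ xs ys p<

nth-++ʳ : ∀ xs ys j → nth (xs ++ ys) (length xs + j) ≡ nth ys j
nth-++ʳ [] ys j = refl
nth-++ʳ (x ∷ xs) ys j = nth-++ʳ xs ys j

nth-drop : ∀ m xs j → nth (drop m xs) j ≡ nth xs (m + j)
nth-drop zero xs j = refl
nth-drop (suc m) [] j = refl
nth-drop (suc m) (x ∷ xs) j = nth-drop m xs j

-- |B_k| = k + 3 + δ k and |C_k| = |B_k| - (k + 1) = 2 + δ k; the recursion for δ comes
-- from |B_{k+1}| = 2 |B_k| - (k + 1).
δ : ℕ → ℕ
δ zero = 0
δ (suc k) = suc (δ k + δ k)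

lenB : ℕ → ℕ
lenB k = 3 + k + δ k

lenC : ℕ → ℕ
lenC k = 2 + δ k

δ-mono : ∀ {m n} → m ≤ n → δ m ≤ δ n
δ-mono z≤n = z≤n
δ-mono (s≤s m≤n) = s≤s (+-mono-≤ (δ-mono m≤n) (δ-mono m≤n))

lenB≡suc+lenC : ∀ k → lenB k ≡ suc k + lenC k
lenB≡suc+lenC k = arith k (δ k)
  where
  arith : ∀ k d → 3 + k + d ≡ suc k + (2 + d)
  arith = solve-∀

lenB-suc : ∀ k → lenB (suc k) ≡ lenB k + lenC k
lenB-suc k = arith k (δ k)
  where
  arith : ∀ k d → 3 + suc k + suc (d + d) ≡ 3 + k + d + (2 + d)
  arith = solve-∀

lenB+δ : ∀ k → lenB k + δ k ≡ suc (suc k) + δ (suc k)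
lenB+δ k = arith k (δ k)
  where
  arith : ∀ k d → 3 + k + d + d ≡ suc (suc k) + suc (d + d)
  arith = solve-∀

lenB-mono : ∀ {m n} → m ≤ n → lenB m ≤ lenB n
lenB-mono m≤n = +-mono-≤ (+-monoʳ-≤ 3 m≤n) (δ-mono m≤n)

n<lenB : ∀ n → n < lenB n
n<lenB n = s≤s (≤-trans (m≤m+n n (δ n)) (m≤n+m (n + δ n) 2))

length-Bword : ∀ k → length (Bword k) ≡ lenB k
length-Bword zero = refl
length-Bword (suc k) = begin
  length (Bword k ++ drop (suc k) (Bword k))       ≡⟨ length-++ (Bword k) ⟩
  length (Bword k) + length (drop (suc k) (Bword k)) ≡⟨ cong (length (Bword k) +_) (length-drop (suc k) (Bword k)) ⟩
  length (Bword k) + (length (Bword k) ∸ suc k)     ≡⟨ cong (λ l → l + (l ∸ suc k)) (trans (length-Bword k) (lenB≡suc+lenC k)) ⟩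
  suc k + lenC k + (suc k + lenC k ∸ suc k)         ≡⟨ cong₂ _+_ (sym (lenB≡suc+lenC k)) (m+n∸m≡n (suc k) (lenC k)) ⟩
  lenB k + lenC k                                   ≡⟨ sym (lenB-suc k) ⟩
  lenB (suc k) ∎

nth-Bword-+ : ∀ m k {p} → p < lenB k → nth (Bword (m + k)) p ≡ nth (Bword k) p
nth-Bword-+ zero k p< = refl
nth-Bword-+ (suc m) k {p} p< = trans (nth-++ˡ (Bword (m + k)) _ p<′) (nth-Bword-+ m k p<)
  where
  p<′ : p < length (Bword (m + k))
  p<′ = subst (p <_) (sym (length-Bword (m + k))) (<-≤-trans p< (lenB-mono (m≤n+m k m)))

b≡nth-Bword : ∀ k {p} → p < lenB k → b p ≡ nth (Bword k) p
b≡nth-Bword k {p} p< = begin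
  nth (Bword p) p       ≡⟨ sym (nth-Bword-+ k p (n<lenB p)) ⟩
  nth (Bword (k + p)) p ≡⟨ cong (λ m → nth (Bword m) p) (+-comm k p) ⟩
  nth (Bword (p + k)) p ≡⟨ nth-Bword-+ p k p< ⟩
  nth (Bword k) p       ∎

b-junction : ∀ k {j} → j < lenC k → b (lenB k + j) ≡ b (suc k + j)
b-junction k {j} j< = begin
  b (lenB k + j)                                ≡⟨ b≡nth-Bword (suc k) (subst (lenB k + j <_) (sym (lenB-suc k)) (+-monoʳ-< (lenB k) j<)) ⟩
  nth (Bword (suc k)) (lenB k + j)              ≡⟨ cong (λ l → nth (Bword (suc k)) (l + j)) (sym (length-Bword k)) ⟩
  nth (Bword (suc k)) (length (Bword k) + j)    ≡⟨ nth-++ʳ (Bword k) _ j ⟩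
  nth (drop (suc k) (Bword k)) j                ≡⟨ nth-drop (suc k) (Bword k) j ⟩
  nth (Bword k) (suc k + j)                     ≡⟨ sym (b≡nth-Bword k (subst (suc k + j <_) (sym (lenB≡suc+lenC k)) (+-monoʳ-< (suc k) j<))) ⟩
  b (suc k + j)                                 ∎

b-penultimate-of-B : ∀ k → b (suc k + δ k) ≡ false
b-penultimate-of-B zero = refl
b-penultimate-of-B (suc k) = begin
  b (suc (suc k) + δ (suc k)) ≡⟨ cong b (sym (lenB+δ k)) ⟩
  b (lenB k + δ k)            ≡⟨ b-junction k (s≤s (n≤1+n (δ k))) ⟩
  b (suc k + δ k)             ≡⟨ b-penultimate-of-B k ⟩
  false                       ∎

b-last-of-B : ∀ k → b (suc (suc k + δ k)) ≡ true
b-last-of-B zero = refl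
b-last-of-B (suc k) = begin
  b (suc (suc (suc k) + δ (suc k))) ≡⟨ cong (b ∘ suc) (sym (lenB+δ k)) ⟩
  b (suc (lenB k + δ k))            ≡⟨ cong b (sym (+-suc (lenB k) (δ k))) ⟩
  b (lenB k + suc (δ k))            ≡⟨ b-junction k ≤-refl ⟩
  b (suc k + suc (δ k))             ≡⟨ cong b (+-suc (suc k) (δ k)) ⟩
  b (suc (suc k + δ k))             ≡⟨ b-last-of-B k ⟩
  true                              ∎

b-no00-below : ∀ k {p} → suc p < lenB k → b p ≡ false → b (suc p) ≡ true
b-no00-below zero {zero} _ ()
b-no00-below zero {suc zero} _ _ = refl
b-no00-below zero {suc (suc p)} (s<s (s<s (s<s ())))
b-no00-below (suc k) {p} p< bp with <-cmp (suc p) (lenB k)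
... | tri< p<′ _ _ = b-no00-below k p<′ bp
... | tri≈ _ refl _ with () ← trans (sym (b-last-of-B k)) bp
... | tri> _ _ lenB<  with j , refl ← m≤n⇒∃[o]m+o≡n (≤-pred lenB<) = begin
  b (suc (lenB k + j))   ≡⟨ cong b (sym (+-suc (lenB k) j)) ⟩
  b (lenB k + suc j)     ≡⟨ b-junction k sj< ⟩
  b (suc k + suc j)      ≡⟨ cong b (+-suc (suc k) j) ⟩
  b (suc (suc k + j))    ≡⟨ b-no00-below k {suc k + j} sksj< (trans (sym (b-junction k (<-trans (n<1+n j) sj<))) bp) ⟩
  true                   ∎
  where
  sj< : suc j < lenC k
  sj< = +-cancelˡ-< (lenB k) (suc j) (lenC k) (subst₂ _<_ (sym (+-suc (lenB k) j)) (lenB-suc k) p<)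
  sksj< : suc (suc k + j) < lenB k
  sksj< = subst₂ _<_ (+-suc (suc k) j) (sym (lenB≡suc+lenC k)) (+-monoʳ-< (suc k) sj<)

b-no00 : ∀ {p} → b p ≡ false → b (suc p) ≡ true
b-no00 {p} = b-no00-below (suc p) (n<lenB (suc p))

No00-∷∷ : ∀ {n c c′ w} → (c ≡ false → c′ ≡ true) → No00 (suc n) (c′ ∷ w) → No00 n w → No00 (2 + n) (c ∷ c′ ∷ w)
No00-∷∷ {c = true} _ c′w _ = 1∷ c′w
No00-∷∷ {c = false} next-true _ w rewrite next-true refl = 01∷ w

window-No00 : ∀ i n → No00 n (window i n)
window-No00 i zero = []
window-No00 i (suc zero) with b i
... | true = 1∷ []
... | false = [0]
window-No00 i (suc (suc n)) = No00-∷∷ (b-no00 {i}) (window-No00 (suc i) (suc n)) (window-No00 (2 + i) n)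

window-cong : ∀ p q n → (∀ {j} → j < n → b (p + j) ≡ b (q + j)) → window p n ≡ window q n
window-cong p q zero _ = refl
window-cong p q (suc n) agree = cong₂ _∷_ head (window-cong (suc p) (suc q) n tail)
  where
  head : b p ≡ b q
  head = subst₂ (λ x y → b x ≡ b y) (+-identityʳ p) (+-identityʳ q) (agree z<s)
  tail : ∀ {j} → j < n → b (suc p + j) ≡ b (suc q + j)
  tail {j} j<n = subst₂ (λ x y → b x ≡ b y) (+-suc p j) (+-suc q j) (agree (s<s j<n))

window-junction : ∀ k {n} → n ≤ lenC k → window (lenB k) n ≡ window (suc k) n
window-junction k {n} n≤ = window-cong (lenB k) (suc k) n (λ j<n → b-junction k (<-≤-trans j<n n≤))

PrefixOfC : ℕ → ℕ → List Bool → Set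
PrefixOfC k n w = n ≤ lenC k × w ≡ window (suc k) n

lenC-mono : ∀ {m n} → m ≤ n → lenC m ≤ lenC n
lenC-mono m≤n = +-monoʳ-≤ 2 (δ-mono m≤n)

lenC-suc : ∀ k → lenC (suc k) ≡ suc (δ k) + lenC k
lenC-suc k = arith (δ k)
  where
  arith : ∀ d → 2 + suc (d + d) ≡ suc d + (2 + d)
  arith = solve-∀

lenC-suc-≤ : ∀ {k m} → suc k ≤ m → suc (δ k) + lenC k ≤ lenC m
lenC-suc-≤ {k} {m} k<m = subst (_≤ lenC m) (lenC-suc k) (lenC-mono k<m)

PrefixOfC-1∷ : ∀ {k n w} → PrefixOfC k n w → PrefixOfC (suc k + δ k) (suc n) (true ∷ w)
PrefixOfC-1∷ {k} (n≤ , refl) =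
  ≤-trans (+-mono-≤ (s≤s z≤n) n≤) (lenC-suc-≤ (m≤m+n (suc k) (δ k))) ,
  cong₂ _∷_ (sym (b-last-of-B k)) (sym (window-junction k n≤))

PrefixOfC-01∷ : ∀ {k n w} → PrefixOfC (suc k) n w → PrefixOfC (suc k + δ (suc k)) (2 + n) (false ∷ true ∷ w)
PrefixOfC-01∷ {k} (n≤ , refl) =
  ≤-trans (+-mono-≤ (s≤s (s≤s z≤n)) n≤) (lenC-suc-≤ (m<m+n (suc k) z<s)) ,
  cong₂ _∷_ (sym (b-penultimate-of-B (suc k))) (cong₂ _∷_ (sym (b-last-of-B (suc k))) (sym (window-junction (suc k) n≤)))

No00⇒PrefixOfC : ∀ {n w} → No00 n w → ∃ λ k → PrefixOfC (suc k) n w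
No00⇒PrefixOfC [] = 0 , z≤n , refl
No00⇒PrefixOfC [0] = 1 , s≤s z≤n , refl
No00⇒PrefixOfC (1∷ v) with _ , pre ← No00⇒PrefixOfC v = _ , PrefixOfC-1∷ pre
No00⇒PrefixOfC (01∷ v) with _ , pre ← No00⇒PrefixOfC v = _ , PrefixOfC-01∷ pre

IsFactor⇔No00 : ∀ {n w} → IsFactor n w ⇔ No00 n w
IsFactor⇔No00 {n} = mk⇔ (λ { (i , refl) → window-No00 i n }) No00⇒IsFactor
  where
  No00⇒IsFactor : ∀ {w} → No00 n w → IsFactor n w
  No00⇒IsFactor v with _ , _ , occurs ← No00⇒PrefixOfC v = _ , occurs

corollary8 : (n : ℕ) → Σ (List (List Bool)) λ ws →
    Unique ws × (∀ w → (w ∈ ws ⇔ IsFactor n w)) × length ws ≡ F (n + 2)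
corollary8 n =
  no00Words n ,
  no00Words-unique n ,
  (λ w → ⇔.trans ∈-no00Words⇔ (⇔.sym IsFactor⇔No00)) ,
  trans (length-no00Words n) (cong F (+-comm 2 n))
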